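{- A permutation $\pi$ avoids the bivincular pattern $(2143,\{2\},\emptyset)$ if and only if it avoids the bivincular pattern $(2143,\emptyset,\{2\})$.
   Context: A bivincular pattern is a triple $(p,X,Y)$ with $p\in S_k$ and $X,Y\subseteq\{0,\dots,k\}$. An occurrence of $(p,X,Y)$ in $\pi\in S_n$ is a subsequence $\pi_{i_1}\cdots\pi_{i_k}$ ($i_1<\dots<i_k$) whose letters are in the same relative order as those of $p$, such that $i_{x+1}=i_x+1$ for all $x\in X$ and $j_{y+1}=j_y+1$ for all $y\in Y$, where $j_1<\dots<j_k$ are the values of the subsequence in increasing order. Thus an occurrence of $(2143,\{2\},\emptyset)$ is an occurrence of $2143$ whose second and third letters are adjacent in $\pi$, and an occurrence of $(2143,\emptyset,\{2\})$ is an occurrence of $2143$ in which the letters playing the roles of $2$ and $3$ are consecutive integers. $\pi$ avoids the pattern if there is no occurrence. -}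

module Defs where

open import Data.Nat using (ℕ; zero; suc; _+_; _<_; _≤_)
open import Data.Fin using (Fin; toℕ; zero; suc)
open import Data.Fin.Permutation using (Permutation′; permutation; _⟨$⟩ʳ_; _⟨$⟩ˡ_)
open import Function.Bundles using (_⇔_)
open import Data.List using (List; []; _∷_)
open import Data.List.Membership.Propositional using (_∈_)
open import Data.Product using (Σ; _×_; ∃)
open import Relation.Binary.PropositionalEquality using (_≡_; refl)
open import Relation.Nullary using (¬_)

-- Permutations of {1..n} are bijections of Fin n (0-based internally).
-- We work with 1-based ℕ-valued positions/values, with sentinels
-- position/value 0 before the first index and n+1 after the last,
-- so that an element x ∈ X with 0 ≤ x ≤ k means "i_{x+1} = i_x + 1"
-- where i_0 = 0 and i_{k+1} = n + 1 (the standard bivincular convention).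

val : ∀ {n} → Permutation′ n → Fin n → ℕ
val π a = suc (toℕ (π ⟨$⟩ʳ a))

-- A bivincular pattern: p ∈ S_k and X, Y ⊆ {0,…,k} given as lists.
record Bivincular : Set where
  constructor bivincular
  field
    k : ℕ
    patt : Permutation′ k
    X : List ℕ
    Y : List ℕ

extend : ∀ {k} → ℕ → (Fin k → ℕ) → ℕ → ℕ
extend {k} n s zero = zero
extend {k} n s (suc m) with Data.Nat._<?_ m k
... | Relation.Nullary.yes m<k = s (Data.Fin.fromℕ< m<k)
... | Relation.Nullary.no _ = suc n

-- An occurrence of (p,X,Y) in π ∈ S_n: positions given by a strictly
-- increasing map ι : Fin k → Fin n (i_a = ι a, 1-based: toℕ (ι a) + 1),
-- letters order-isomorphic to p, position adjacency for X, value
-- adjacency for Y.  The sorted values j_1 < … < j_k: the value playing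
-- role r is π(ι(p⁻¹(r))), so j_r = val π (ι (p ⟨$⟩ˡ r)).
Occurs : ∀ {n} → Bivincular → Permutation′ n → Set
Occurs {n} (bivincular k p X Y) π =
  Σ (Fin k → Fin n) λ ι →
    (∀ a b → toℕ a < toℕ b → toℕ (ι a) < toℕ (ι b)) ×
    (∀ a b → (val π (ι a) < val π (ι b)) ⇔ (val p a < val p b)) ×
    (∀ x → x ∈ X → extend n (λ a → suc (toℕ (ι a))) (suc x)
                     ≡ suc (extend n (λ a → suc (toℕ (ι a))) x)) ×
    (∀ y → y ∈ Y → extend n (λ r → val π (ι (p ⟨$⟩ˡ r))) (suc y)
                     ≡ suc (extend n (λ r → val π (ι (p ⟨$⟩ˡ r))) y))

Avoids : ∀ {n} → Bivincular → Permutation′ n → Set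
Avoids B π = ¬ Occurs B π

-- the pattern 2143 ∈ S_4 (0-based: 1,0,3,2), an involution
p2143 : Permutation′ 4
p2143 = permutation f f (λ { zero → refl ; (suc zero) → refl ; (suc (suc zero)) → refl ; (suc (suc (suc zero))) → refl })
                        (λ { zero → refl ; (suc zero) → refl ; (suc (suc zero)) → refl ; (suc (suc (suc zero))) → refl })
  where
  f : Fin 4 → Fin 4
  f zero = suc zero
  f (suc zero) = zero
  f (suc (suc zero)) = suc (suc (suc zero))
  f (suc (suc (suc zero))) = suc (suc zero)

-- An occurrence of 2143 is four positions i₁ < i₂ < i₃ < i₄ with π(i₂) < π(i₁) < π(i₄) < π(i₃).
-- Suppose i₃ = i₂ + 1 and let p be the position of the value π(i₁) + 1.  The value inequalities
-- rule out p = i₂ and p = i₃, and nothing lies strictly between i₂ and i₃, so either p < i₂,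
-- and p replaces i₁ with a smaller value gap to π(i₄), or p > i₃, and p replaces i₄, making
-- the values of the first and last letters adjacent.  Passing to π⁻¹ maps occurrences of
-- the involution 2143 to occurrences of 2143 and turns adjacent values into adjacent
-- positions, which gives the converse.
module Submission where

open import Defs
open import Data.Nat using (ℕ; zero; suc; _+_; _<_; _≤_; s≤s; s<s⁻¹)
open import Data.Nat.Properties
  using (<-cmp; <-trans; ≤-<-trans; <-irrefl; <-asym; ≤-refl; ≤∧≢⇒<; n<1+n; m≤n+m; +-suc; m∸n+n≡m; suc-injective)
open import Data.List using ([]; _∷_)
open import Data.List.Relation.Unary.Any using (here; there)
open import Data.Fin using (Fin; toℕ; fromℕ<; zero; suc)
open import Data.Fin.Properties using (toℕ-injective; toℕ-fromℕ<; toℕ<n)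
open import Data.Fin.Permutation using (Permutation′; _⟨$⟩ʳ_; _⟨$⟩ˡ_; inverseʳ; inverseˡ; flip)
open import Function.Base using (_∘_)
open import Function.Bundles using (_⇔_; mk⇔; Equivalence)
open import Data.Product using (Σ; _,_; proj₁; proj₂)
open import Data.Empty using (⊥-elim)
open import Relation.Binary using (Tri; tri<; tri≈; tri>)
open import Relation.Binary.PropositionalEquality using (_≡_; refl; sym; trans; cong; subst; subst₂)

strictMono⇒reflects-< : {A : Set} (f g : A → ℕ) → (∀ {a b} → g a ≡ g b → a ≡ b) →
  (∀ a b → g a < g b → f a < f b) → ∀ a b → f a < f b → g a < g b
strictMono⇒reflects-< f g g-injective mono a b fa<fb with <-cmp (g a) (g b)
... | tri< ga<gb _ _ = ga<gb
... | tri≈ _ ga≡gb _ = ⊥-elim (<-irrefl (cong f (g-injective ga≡gb)) fa<fb)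
... | tri> _ _ gb<ga = ⊥-elim (<-asym fa<fb (mono b a gb<ga))

increasing₄ : (f : Fin 4 → ℕ) →
  f zero < f (suc zero) → f (suc zero) < f (suc (suc zero)) →
  f (suc (suc zero)) < f (suc (suc (suc zero))) →
  ∀ a b → toℕ a < toℕ b → f a < f b
increasing₄ f f₀<f₁ f₁<f₂ f₂<f₃ = go
  where
  go : ∀ a b → toℕ a < toℕ b → f a < f b
  go a zero ()
  go zero (suc zero) _ = f₀<f₁
  go zero (suc (suc zero)) _ = <-trans f₀<f₁ f₁<f₂
  go zero (suc (suc (suc zero))) _ = <-trans f₀<f₁ (<-trans f₁<f₂ f₂<f₃)
  go (suc a) (suc zero) (s≤s ())
  go (suc zero) (suc (suc zero)) _ = f₁<f₂
  go (suc zero) (suc (suc (suc zero))) _ = <-trans f₁<f₂ f₂<f₃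
  go (suc (suc a)) (suc (suc zero)) (s≤s (s≤s ()))
  go (suc (suc zero)) (suc (suc (suc zero))) _ = f₂<f₃
  go (suc (suc (suc a))) (suc (suc (suc zero))) (s≤s (s≤s (s≤s ())))

value : ∀ {n} → Permutation′ n → Fin n → ℕ
value π i = toℕ (π ⟨$⟩ʳ i)

value-injective : ∀ {n} (π : Permutation′ n) {i j} → value π i ≡ value π j → i ≡ j
value-injective π eq = trans (sym (inverseˡ π)) (trans (cong (π ⟨$⟩ˡ_) (toℕ-injective eq)) (inverseˡ π))

positionOf : ∀ {n} (π : Permutation′ n) v → v < n → Σ (Fin n) λ i → value π i ≡ v
positionOf π v v<n = π ⟨$⟩ˡ fromℕ< v<n , trans (cong toℕ (inverseʳ π)) (toℕ-fromℕ< v<n)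

value-flip : ∀ {n} (π : Permutation′ n) i → value (flip π) (π ⟨$⟩ʳ i) ≡ toℕ i
value-flip π i = cong toℕ (inverseˡ π)

record Occurrence2143 {n} (π : Permutation′ n) : Set where
  constructor occurrence
  field
    i₁ i₂ i₃ i₄ : Fin n
    i₁<i₂ : toℕ i₁ < toℕ i₂
    i₂<i₃ : toℕ i₂ < toℕ i₃
    i₃<i₄ : toℕ i₃ < toℕ i₄
    π₂<π₁ : value π i₂ < value π i₁
    π₁<π₄ : value π i₁ < value π i₄
    π₄<π₃ : value π i₄ < value π i₃

open Occurrence2143

-- In 2143 the letters playing the values 2 and 3 are the first and the last one.
PositionAdjacent ValueAdjacent : ∀ {n} {π : Permutation′ n} → Occurrence2143 π → Set
PositionAdjacent o = toℕ (i₃ o) ≡ suc (toℕ (i₂ o))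
ValueAdjacent {π = π} o = value π (i₄ o) ≡ suc (value π (i₁ o))

transpose : ∀ {n} {π : Permutation′ n} → Occurrence2143 π → Occurrence2143 (flip π)
transpose {π = π} (occurrence i₁ i₂ i₃ i₄ i₁<i₂ i₂<i₃ i₃<i₄ π₂<π₁ π₁<π₄ π₄<π₃) =
  occurrence (π ⟨$⟩ʳ i₂) (π ⟨$⟩ʳ i₁) (π ⟨$⟩ʳ i₄) (π ⟨$⟩ʳ i₃) π₂<π₁ π₁<π₄ π₄<π₃
    (subst₂ _<_ (sym (value-flip π i₁)) (sym (value-flip π i₂)) i₁<i₂)
    (subst₂ _<_ (sym (value-flip π i₂)) (sym (value-flip π i₃)) i₂<i₃)
    (subst₂ _<_ (sym (value-flip π i₃)) (sym (value-flip π i₄)) i₃<i₄)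

transpose-valueAdjacent : ∀ {n} {π : Permutation′ n} (o : Occurrence2143 π) →
  ValueAdjacent o → PositionAdjacent (transpose o)
transpose-valueAdjacent o adjacent = adjacent

valueAdjacent-from-positionAdjacent : ∀ {n} {π : Permutation′ n} →
  Σ (Occurrence2143 π) PositionAdjacent → Σ (Occurrence2143 π) ValueAdjacent
valueAdjacent-from-positionAdjacent {n} {π} (o , adjacent) =
  shrink _ o adjacent (sym (m∸n+n≡m (π₁<π₄ o)))
  where
  shrink : ∀ d (o : Occurrence2143 π) → PositionAdjacent o →
    value π (i₄ o) ≡ d + suc (value π (i₁ o)) →
    Σ (Occurrence2143 π) ValueAdjacent
  shrink zero o _ gap = o , gap
  shrink (suc d) (occurrence i₁ i₂ i₃ i₄ i₁<i₂ i₂<i₃ i₃<i₄ π₂<π₁ π₁<π₄ π₄<π₃) adjacent gap =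
    insert (<-cmp (toℕ p) (toℕ i₂))
    where
    next : Σ (Fin n) λ p → value π p ≡ suc (value π i₁)
    next = positionOf π (suc (value π i₁)) (≤-<-trans π₁<π₄ (toℕ<n (π ⟨$⟩ʳ i₄)))
    p : Fin n
    p = proj₁ next
    πp≡ : value π p ≡ suc (value π i₁)
    πp≡ = proj₂ next
    π₁<πp : value π i₁ < value π p
    π₁<πp = subst (value π i₁ <_) (sym πp≡) (n<1+n _)
    π₂<πp : value π i₂ < value π p
    π₂<πp = <-trans π₂<π₁ π₁<πp
    πp<π₄ : value π p < value π i₄
    πp<π₄ = subst₂ _<_ (sym πp≡) (sym gap) (s≤s (m≤n+m _ d))
    πp<π₃ : value π p < value π i₃
    πp<π₃ = <-trans πp<π₄ π₄<π₃
    insert : Tri (toℕ p < toℕ i₂) (toℕ p ≡ toℕ i₂) (toℕ i₂ < toℕ p) → Σ (Occurrence2143 π) ValueAdjacent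
    insert (tri< p<i₂ _ _) =
      shrink d (occurrence p i₂ i₃ i₄ p<i₂ i₂<i₃ i₃<i₄ π₂<πp πp<π₄ π₄<π₃) adjacent
        (trans gap (sym (trans (cong (λ x → d + suc x) πp≡) (+-suc d _))))
    insert (tri≈ _ p≡i₂ _) = ⊥-elim (<-irrefl (sym (cong (value π) (toℕ-injective p≡i₂))) π₂<πp)
    insert (tri> _ _ i₂<p) = occurrence i₁ i₂ i₃ p i₁<i₂ i₂<i₃ i₃<p π₂<π₁ π₁<πp πp<π₃ , πp≡
      where
      i₃<p : toℕ i₃ < toℕ p
      i₃<p = ≤∧≢⇒< (subst (_≤ toℕ p) (sym adjacent) i₂<p)
        (λ i₃≡p → <-irrefl (sym (cong (value π) (toℕ-injective i₃≡p))) πp<π₃)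

positionAdjacent-from-valueAdjacent : ∀ {n} {π : Permutation′ n} →
  Σ (Occurrence2143 π) ValueAdjacent → Σ (Occurrence2143 π) PositionAdjacent
positionAdjacent-from-valueAdjacent (o , adjacent)
  with valueAdjacent-from-positionAdjacent (transpose o , transpose-valueAdjacent o adjacent)
... | o′ , adjacent′ = transpose o′ , transpose-valueAdjacent o′ adjacent′

vincular2143 covincular2143 : Bivincular
vincular2143 = bivincular 4 p2143 (2 ∷ []) []
covincular2143 = bivincular 4 p2143 [] (2 ∷ [])

module _ {n} {π : Permutation′ n} where
  Increasing : (Fin 4 → Fin n) → Set
  Increasing ι = ∀ a b → toℕ a < toℕ b → toℕ (ι a) < toℕ (ι b)

  OrderIsomorphic : (Fin 4 → Fin n) → Set
  OrderIsomorphic ι = ∀ a b → (val π (ι a) < val π (ι b)) ⇔ (val p2143 a < val p2143 b)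

  occurrence-from-embedding : (ι : Fin 4 → Fin n) → Increasing ι → OrderIsomorphic ι → Occurrence2143 π
  occurrence-from-embedding ι increasing orderIso =
    occurrence (ι zero) (ι (suc zero)) (ι (suc (suc zero))) (ι (suc (suc (suc zero))))
      (increasing zero (suc zero) ≤-refl)
      (increasing (suc zero) (suc (suc zero)) ≤-refl)
      (increasing (suc (suc zero)) (suc (suc (suc zero))) ≤-refl)
      (s<s⁻¹ (Equivalence.from (orderIso (suc zero) zero) ≤-refl))
      (s<s⁻¹ (Equivalence.from (orderIso zero (suc (suc (suc zero)))) ≤-refl))
      (s<s⁻¹ (Equivalence.from (orderIso (suc (suc (suc zero))) (suc (suc zero))) ≤-refl))

  embedding : Occurrence2143 π → Fin 4 → Fin n
  embedding o zero = i₁ o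
  embedding o (suc zero) = i₂ o
  embedding o (suc (suc zero)) = i₃ o
  embedding o (suc (suc (suc zero))) = i₄ o

  embedding-increasing : (o : Occurrence2143 π) → Increasing (embedding o)
  embedding-increasing o =
    increasing₄ (λ a → toℕ (embedding o a)) (i₁<i₂ o) (i₂<i₃ o) (i₃<i₄ o)

  embedding-orderIsomorphic : (o : Occurrence2143 π) → OrderIsomorphic (embedding o)
  embedding-orderIsomorphic o a b =
    mk⇔ (strictMono⇒reflects-< (val π ∘ ι) (val p2143)
           (λ eq → value-injective p2143 (suc-injective eq)) preserves a b)
        (preserves a b)
    where
    ι : Fin 4 → Fin n
    ι = embedding o
    inRoleOrder : Fin 4 → ℕ
    inRoleOrder r = value π (ι (p2143 ⟨$⟩ˡ r))
    preserves : ∀ a b → val p2143 a < val p2143 b → val π (ι a) < val π (ι b)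
    preserves a b pa<pb = s≤s (subst₂ (λ x y → value π (ι x) < value π (ι y))
      (inverseˡ p2143 {a}) (inverseˡ p2143 {b})
      (increasing₄ inRoleOrder (π₂<π₁ o) (π₁<π₄ o) (π₄<π₃ o)
        (p2143 ⟨$⟩ʳ a) (p2143 ⟨$⟩ʳ b) (s<s⁻¹ pa<pb)))

  fromVincular : Occurs vincular2143 π → Σ (Occurrence2143 π) PositionAdjacent
  fromVincular (ι , increasing , orderIso , adjacent , _) =
    occurrence-from-embedding ι increasing orderIso , suc-injective (adjacent 2 (here refl))

  fromCovincular : Occurs covincular2143 π → Σ (Occurrence2143 π) ValueAdjacent
  fromCovincular (ι , increasing , orderIso , _ , adjacent) =
    occurrence-from-embedding ι increasing orderIso , suc-injective (adjacent 2 (here refl))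

  toVincular : Σ (Occurrence2143 π) PositionAdjacent → Occurs vincular2143 π
  toVincular (o , adjacent) =
    embedding o , embedding-increasing o , embedding-orderIsomorphic o ,
    (λ { _ (here refl) → cong suc adjacent ; _ (there ()) }) , (λ _ ())

  toCovincular : Σ (Occurrence2143 π) ValueAdjacent → Occurs covincular2143 π
  toCovincular (o , adjacent) =
    embedding o , embedding-increasing o , embedding-orderIsomorphic o ,
    (λ _ ()) , (λ { _ (here refl) → cong suc adjacent ; _ (there ()) })

mainTheorem6 : (n : ℕ) (π : Permutation′ n) →
    Avoids (bivincular 4 p2143 (2 ∷ []) []) π ⇔ Avoids (bivincular 4 p2143 [] (2 ∷ [])) π
mainTheorem6 n π = mk⇔
  (λ avoidsVincular → avoidsVincular ∘ toVincular ∘ positionAdjacent-from-valueAdjacent ∘ fromCovincular {π = π})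
  (λ avoidsCovincular → avoidsCovincular ∘ toCovincular ∘ valueAdjacent-from-positionAdjacent ∘ fromVincular {π = π})
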